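{- Let $G$ be a signed digraph. If all the negative arcs of $G$ have the same terminal vertex, then $G$ is trapping.
   Context: A signed digraph $G=(V,E)$ has finite vertex set $V$ and arcs $E\subseteq V\times V\times\{ -1,1\}$ ($(j,i,s)$: arc from $j$ to $i$, terminal vertex $i$, sign $s$). A BN on $V$ is $f:\{0,1\}^V\to\{0,1\}^V$; $G(f)$ has a positive (negative) arc from $j$ to $i$ iff for some $x$ with $x_j=0$, $f_i(x+e_j)-f_i(x)$ is positive (negative) ($e_j$ = configuration equal to $1$ only at $j$, $+$ mod 2); $F(G)=\{f:G(f)=G\}$. $\Gamma(f)$ is the digraph on $\{0,1\}^V$ with arcs $x\to x+e_i$ whenever $f_i(x)\neq x_i$. A trap set has no outgoing arc; an attractor is an inclusion-minimal nonempty trap set. A subspace is $\{x:x_i=c(i)\ \forall i\in I\}$; $[X]$ the smallest subspace containing $X$; a trap space is a subspace that is a trap set; $\langle X\rangle$ the smallest trap space containing $X$. $\Gamma(f)$ is trapping if $[A]\cap[B]=\emptyset$ for all distinct attractors and $[A]=\langle A\rangle$ for all attractors $A$; $G$ is trapping if $\Gamma(f)$ is trapping for all $f\in F(G)$. -}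

module Defs where

open import Data.Nat using (ℕ)
open import Data.Fin using (Fin)
open import Data.Bool using (Bool; true; false; not)
open import Data.Maybe using (Maybe; just)
open import Data.Vec using (Vec; lookup; updateAt)
open import Data.Product using (Σ; ∃; _×_; _,_)
open import Relation.Binary.PropositionalEquality using (_≡_; _≢_)
open import Relation.Nullary using (¬_)
open import Function.Bundles using (_⇔_)

-- Vertex set V = Fin n. Configurations {0,1}^V as Vec Bool n (false = 0, true = 1).
Config : ℕ → Set
Config n = Vec Bool n

flipAt : ∀ {n} → Config n → Fin n → Config n
flipAt x i = updateAt x i not

BN : ℕ → Set
BN n = Config n → Config n

data Sign : Set where
  pos neg : Sign

-- A signed digraph on V: G j i s ≡ true iff (j , i , s) ∈ E (arc from j to i with sign s)
SignedDigraph : ℕ → Set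
SignedDigraph n = Fin n → Fin n → Sign → Bool

ArcOf : ∀ {n} → BN n → Fin n → Fin n → Sign → Set
ArcOf f j i pos = ∃ λ x → lookup x j ≡ false × lookup (f x) i ≡ false × lookup (f (flipAt x j)) i ≡ true
ArcOf f j i neg = ∃ λ x → lookup x j ≡ false × lookup (f x) i ≡ true × lookup (f (flipAt x j)) i ≡ false

InF : ∀ {n} → SignedDigraph n → BN n → Set
InF G f = ∀ j i s → ArcOf f j i s ⇔ (G j i s ≡ true)

-- Sets of configurations (finite set, so Bool-valued subsets capture all subsets)
CSet : ℕ → Set
CSet n = Config n → Bool

_∈_ : ∀ {n} → Config n → CSet n → Set
x ∈ X = X x ≡ true

-- Trap set of Γ(f): no arc x → x + e_i (with f_i(x) ≠ x_i) leaves it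
TrapSet : ∀ {n} → BN n → CSet n → Set
TrapSet f T = ∀ x i → x ∈ T → lookup (f x) i ≢ lookup x i → flipAt x i ∈ T

NonEmpty : ∀ {n} → CSet n → Set
NonEmpty X = ∃ λ x → x ∈ X

_⊆_ : ∀ {n} → CSet n → CSet n → Set
X ⊆ Y = ∀ x → x ∈ X → x ∈ Y

Attractor : ∀ {n} → BN n → CSet n → Set
Attractor f A = NonEmpty A × TrapSet f A ×
  (∀ T → NonEmpty T → TrapSet f T → T ⊆ A → A ⊆ T)

-- Subspaces, described by a code c : c i = just b fixes x_i = b, nothing leaves i free
SubCode : ℕ → Set
SubCode n = Vec (Maybe Bool) n

InSub : ∀ {n} → SubCode n → Config n → Set
InSub c x = ∀ i b → lookup c i ≡ just b → lookup x i ≡ b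

IsTrapSpace : ∀ {n} → BN n → SubCode n → Set
IsTrapSpace f c = ∀ x i → InSub c x → lookup (f x) i ≢ lookup x i → InSub c (flipAt x i)

InSubHull : ∀ {n} → CSet n → Config n → Set
InSubHull X y = ∀ c → (∀ x → x ∈ X → InSub c x) → InSub c y

InTrapHull : ∀ {n} → BN n → CSet n → Config n → Set
InTrapHull f X y = ∀ c → IsTrapSpace f c → (∀ x → x ∈ X → InSub c x) → InSub c y

TrappingΓ : ∀ {n} → BN n → Set
TrappingΓ f =
  (∀ A B → Attractor f A → Attractor f B → ¬ (∀ x → A x ≡ B x) →
     ¬ (∃ λ y → InSubHull A y × InSubHull B y))
  × (∀ A → Attractor f A → ∀ y → InSubHull A y ⇔ InTrapHull f A y)

TrappingG : ∀ {n} → SignedDigraph n → Set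
TrappingG G = ∀ f → InF G f → TrappingΓ f

NegArcsSameTarget : ∀ {n} → SignedDigraph n → Set
NegArcsSameTarget G = ∀ j i j' i' → G j i neg ≡ true → G j' i' neg ≡ true → i ≡ i'

{-# OPTIONS --safe #-}
-- Let i be the common target of all negative arcs, so that every f k with k ≢ i is monotone.
-- Call q a b-anchor if q i = not b and, for k ≢ i, q k = b implies f k q = b. For b = true the
-- up-set {x | q ≤ x} of an anchor is a trap set (a move at k ≢ i out of it would contradict
-- monotonicity, and coordinate i is unconstrained); dually for b = false. So an attractor
-- containing a true-anchor has it as least element, and one containing a false-anchor has it as
-- greatest element. Walking first down and then up along the coordinates k ≢ i, every attractor A
-- is seen to contain either a fixed point p, and then A = {p}, or a true-anchor lo and a
-- false-anchor hi; then A lies in the interval [lo, hi], which is a trap space by monotonicity,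
-- so [A] = [lo, hi] = ⟨A⟩. If y ∈ [A] ∩ [B] and b = not (y i), the b-ends of A and B are anchors
-- lying ≼-below a point of the other attractor, hence they coincide and A = B.
module Submission where

open import Defs
open import Data.Nat using (ℕ; zero; suc; _<_; s≤s)
open import Data.Nat.Induction using (<-wellFounded)
open import Data.Nat.Properties using (n<1+n)
open import Data.Fin using (Fin) renaming (zero to fzero; suc to fsuc)
open import Data.Fin.Properties using (any?; all?) renaming (_≟_ to _≟ᶠ_)
open import Data.Bool using (Bool; true; false; not)
open import Data.Bool.Properties using (_≟_; not-involutive; not-¬; ¬-not; ⇔→≡)
open import Data.Maybe using (Maybe; just; nothing)
open import Data.Vec using ([]; _∷_; lookup; tabulate; count)
open import Data.Vec.Properties
  using (≡-dec; lookup∘updateAt; lookup∘updateAt′; lookup∘tabulate; tabulate∘lookup; tabulate-cong)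
open import Data.Product using (Σ-syntax; ∃; ∃-syntax; _×_; _,_; proj₁; proj₂)
open import Data.Unit using (⊤; tt)
open import Data.Empty using (⊥-elim)
open import Function using (_∘_; _on_)
open import Function.Bundles using (_⇔_; mk⇔; Equivalence)
open import Induction.WellFounded using (Acc; acc)
open import Relation.Binary.Construct.On as On using ()
open import Relation.Binary.Definitions using (DecidableEquality)
open import Relation.Binary.PropositionalEquality
  using (_≡_; _≢_; refl; sym; trans; cong; subst; module ≡-Reasoning)
open import Relation.Nullary using (¬_; Dec; yes; no; does)
open import Relation.Nullary.Decidable
  using (_×-dec_; _→-dec_; ¬?; dec-true; dec-false; map′; decidable-stable)
open import Relation.Unary using (Decidable)

variable
  n : ℕ

lookup-ext : {x y : Config n} → (∀ k → lookup x k ≡ lookup y k) → x ≡ y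
lookup-ext {x = x} {y} h = begin
  x                  ≡⟨ tabulate∘lookup x ⟨
  tabulate (lookup x) ≡⟨ tabulate-cong h ⟩
  tabulate (lookup y) ≡⟨ tabulate∘lookup y ⟩
  y                  ∎
  where open ≡-Reasoning

lookup-flipAt : (x : Config n) (k : Fin n) → lookup (flipAt x k) k ≡ not (lookup x k)
lookup-flipAt x k = lookup∘updateAt k x

lookup-flipAt′ : (x : Config n) {j k : Fin n} → j ≢ k → lookup (flipAt x k) j ≡ lookup x j
lookup-flipAt′ x {j} {k} j≢k = lookup∘updateAt′ j k j≢k x

_≟ᶜ_ : DecidableEquality (Config n)
_≟ᶜ_ = ≡-dec _≟_

toCSet : {P : Config n → Set} → Decidable P → CSet n
toCSet P? x = does (P? x)

∈-toCSet⁺ : {P : Config n → Set} (P? : Decidable P) {x : Config n} → P x → x ∈ toCSet P?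
∈-toCSet⁺ P? {x} = dec-true (P? x)

∈-toCSet⁻ : {P : Config n → Set} (P? : Decidable P) {x : Config n} → x ∈ toCSet P? → P x
∈-toCSet⁻ P? {x} x∈ with P? x | x∈
... | yes p | _ = p
... | no _  | ()

-- x ≼[ true ] y is the coordinatewise order x ≤ y, and x ≼[ false ] y is y ≤ x.
record _≼[_]_ (x : Config n) (b : Bool) (y : Config n) : Set where
  constructor ≼⁺
  field
    ≼-at : ∀ j → lookup x j ≡ b → lookup y j ≡ b
open _≼[_]_

_≼?[_]_ : (x : Config n) (b : Bool) (y : Config n) → Dec (x ≼[ b ] y)
x ≼?[ b ] y = map′ ≼⁺ ≼-at (all? λ j → (lookup x j ≟ b) →-dec (lookup y j ≟ b))

module _ {x y : Config n} {b : Bool} where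

  ≼-trans : ∀ {z} → x ≼[ b ] y → y ≼[ b ] z → x ≼[ b ] z
  ≼-trans x≼y y≼z = ≼⁺ λ j → ≼-at y≼z j ∘ ≼-at x≼y j

  ≼-antisym : x ≼[ b ] y → y ≼[ b ] x → x ≡ y
  ≼-antisym x≼y y≼x = lookup-ext pointwise
    where
    pointwise : ∀ j → lookup x j ≡ lookup y j
    pointwise j with lookup x j ≟ b
    ... | yes xj = trans xj (sym (≼-at x≼y j xj))
    ... | no xj≢b = trans (¬-not xj≢b) (sym (¬-not (xj≢b ∘ ≼-at y≼x j)))

  ≼-dual : x ≼[ b ] y → y ≼[ not b ] x
  ≼-dual x≼y = ≼⁺ λ j yj → ¬-not λ xj → not-¬ (≼-at x≼y j xj) yj

  ≼-flipAtˡ : ∀ {k} → x ≼[ b ] y → lookup y k ≡ b → flipAt x k ≼[ b ] y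
  ≼-flipAtˡ {k} x≼y yk = ≼⁺ λ j → at j
    where
    at : ∀ j → lookup (flipAt x k) j ≡ b → lookup y j ≡ b
    at j with j ≟ᶠ k
    ... | yes refl = λ _ → yk
    ... | no j≢k = ≼-at x≼y j ∘ trans (sym (lookup-flipAt′ x j≢k))

  ≼-flipAtʳ : ∀ {k} → x ≼[ b ] y → lookup x k ≢ b → x ≼[ b ] flipAt y k
  ≼-flipAtʳ {k} x≼y xk≢b = ≼⁺ at
    where
    at : ∀ j → lookup x j ≡ b → lookup (flipAt y k) j ≡ b
    at j xj with j ≟ᶠ k
    ... | yes refl = ⊥-elim (xk≢b xj)
    ... | no j≢k = trans (lookup-flipAt′ y j≢k) (≼-at x≼y j xj)

≼-refl : {x : Config n} {b : Bool} → x ≼[ b ] x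
≼-refl = ≼⁺ λ _ xj → xj

≼-flipAt : {x : Config n} {k : Fin n} {b : Bool} → lookup x k ≡ not b → x ≼[ b ] flipAt x k
≼-flipAt xk = ≼-flipAtʳ ≼-refl λ xk≡b → not-¬ xk≡b xk

≼-dual⁻ : {x y : Config n} {b : Bool} → x ≼[ not b ] y → y ≼[ b ] x
≼-dual⁻ {x = x} {y} {b} = subst (y ≼[_] x) (not-involutive b) ∘ ≼-dual

count-flipAt : ∀ b (x : Config n) k → lookup x k ≡ b → count (_≟ b) (flipAt x k) < count (_≟ b) x
count-flipAt b (v ∷ x) fzero refl
  rewrite dec-true (v ≟ v) refl | dec-false (not v ≟ v) (not-¬ refl ∘ sym) = n<1+n _
count-flipAt b (v ∷ x) (fsuc k) xk with v ≟ b
... | yes _ = s≤s (count-flipAt b x k xk)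
... | no _ = count-flipAt b x k xk

flip-induction : (b : Bool) (P : Config n → Set) →
                 (∀ x → (∀ k → lookup x k ≡ b → P (flipAt x k)) → P x) → ∀ x → P x
flip-induction b P step x = go x (On.wellFounded (count (_≟ b)) <-wellFounded x)
  where
  go : ∀ x → Acc (_<_ on count (_≟ b)) x → P x
  go x (acc rs) = step x λ k xk → go (flipAt x k) (rs (count-flipAt b x k xk))

agreeAt : Bool → Bool → Maybe Bool
agreeAt true  true  = just true
agreeAt false false = just false
agreeAt _     _     = nothing

agreeAt-≡ : ∀ {u w} → u ≡ w → agreeAt u w ≡ just u
agreeAt-≡ {true}  refl = refl
agreeAt-≡ {false} refl = refl

agreeAt-just : ∀ u w {v} → agreeAt u w ≡ just v → u ≡ v × w ≡ v
agreeAt-just true  true  refl = refl , refl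
agreeAt-just false false refl = refl , refl

span : Config n → Config n → SubCode n
span x z = tabulate λ k → agreeAt (lookup x k) (lookup z k)

module _ {x z y : Config n} where

  span⁻ : InSub (span x z) y → ∀ k → lookup x k ≡ lookup z k → lookup y k ≡ lookup x k
  span⁻ y∈ k xk≡zk = y∈ k (lookup x k) (trans (lookup∘tabulate _ k) (agreeAt-≡ xk≡zk))

  span⁺ : (∀ k → lookup x k ≡ lookup z k → lookup y k ≡ lookup x k) → InSub (span x z) y
  span⁺ agree k v code≡v with agreeAt-just _ _ (trans (sym (lookup∘tabulate _ k)) code≡v)
  ... | xk≡v , zk≡v = trans (agree k (trans xk≡v (sym zk≡v))) xk≡v

  span-least : ∀ {c} → InSub c x → InSub c z → InSub (span x z) y → InSub c y
  span-least x∈c z∈c y∈ k v ck≡v = trans (span⁻ y∈ k (trans (x∈c k v ck≡v) (sym (z∈c k v ck≡v))))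
                                         (x∈c k v ck≡v)

  span-≼ˡ : ∀ {b} → x ≼[ b ] z → InSub (span x z) y → x ≼[ b ] y
  span-≼ˡ x≼z y∈ = ≼⁺ λ j xj → trans (span⁻ y∈ j (trans xj (sym (≼-at x≼z j xj)))) xj

  span-≼ʳ : ∀ {b} → z ≼[ b ] x → InSub (span x z) y → z ≼[ b ] y
  span-≼ʳ z≼x y∈ = ≼⁺ λ j zj → trans (span⁻ y∈ j (trans (≼-at z≼x j zj) (sym zj))) (≼-at z≼x j zj)

-- For a pair of ends e true ≤ e false, span (e true) (e false) is the interval between them.
module _ (e : Bool → Config n) where

  interval : SubCode n
  interval = span (e true) (e false)

  interval⁺ : ∀ {y} → (∀ b → e b ≼[ b ] y) → InSub interval y
  interval⁺ {y} above = span⁺ {x = e true} {e false} {y} agree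
    where
    agree : ∀ k → lookup (e true) k ≡ lookup (e false) k → lookup y k ≡ lookup (e true) k
    agree k et≡ef with lookup (e true) k in et
    ... | true  = ≼-at (above true) k et
    ... | false = ≼-at (above false) k (sym et≡ef)

  interval⁻ : (∀ b → e b ≼[ b ] e (not b)) → ∀ {y} → InSub interval y → ∀ b → e b ≼[ b ] y
  interval⁻ ordered {y} y∈ true  = span-≼ˡ {z = e false} {y} (ordered true) y∈
  interval⁻ ordered {y} y∈ false = span-≼ʳ {x = e true} {y = y} (ordered false) y∈

both-signs : {P : Bool → Set} (b : Bool) → P b → P (not b) → ∀ c → P c
both-signs false p₀ p₁ false = p₀
both-signs false p₀ p₁ true  = p₁
both-signs true  p₁ p₀ true  = p₁
both-signs true  p₁ p₀ false = p₀

module _ (f : BN n) where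

  subHull⇒trapHull : ∀ {A y} → InSubHull A y → InTrapHull f A y
  subHull⇒trapHull y∈[A] c _ = y∈[A] c

  attractor-⊆-trapSet : ∀ {A T} → Attractor f A → TrapSet f T → ∀ a → a ∈ A → a ∈ T → A ⊆ T
  attractor-⊆-trapSet {A} {T} (_ , A-trap , minimal) T-trap a a∈A a∈T x x∈A =
    proj₂ (∈-toCSet⁻ both? (minimal A∩T (a , ∈-toCSet⁺ both? (a∈A , a∈T)) A∩T-trap
                                    (λ y → proj₁ ∘ ∈-toCSet⁻ both?) x x∈A))
    where
    both? : Decidable (λ x → x ∈ A × x ∈ T)
    both? x = (A x ≟ true) ×-dec (T x ≟ true)
    A∩T : CSet _
    A∩T = toCSet both?
    A∩T-trap : TrapSet f A∩T
    A∩T-trap x k x∈ moves with ∈-toCSet⁻ both? x∈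
    ... | x∈A , x∈T = ∈-toCSet⁺ both? (A-trap x k x∈A moves , T-trap x k x∈T moves)

  attractors-meet⇒≡ : ∀ {A B} → Attractor f A → Attractor f B → ∀ x → x ∈ A → x ∈ B → ∀ z → A z ≡ B z
  attractors-meet⇒≡ A-att B-att x x∈A x∈B z =
    ⇔→≡ (mk⇔ (attractor-⊆-trapSet A-att (proj₁ (proj₂ B-att)) x x∈A x∈B z)
              (attractor-⊆-trapSet B-att (proj₁ (proj₂ A-att)) x x∈B x∈A z))

  Fixed : Config n → Set
  Fixed p = ∀ k → lookup (f p) k ≡ lookup p k

  fixed-attractor-singleton : ∀ {A p} → Attractor f A → p ∈ A → Fixed p → ∀ x → x ∈ A → x ≡ p
  fixed-attractor-singleton {p = p} att p∈A fixed x =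
    ∈-toCSet⁻ (_≟ᶜ p) ∘ attractor-⊆-trapSet att singleton-trap p p∈A (∈-toCSet⁺ (_≟ᶜ p) refl) x
    where
    singleton-trap : TrapSet f (toCSet (_≟ᶜ p))
    singleton-trap z k z∈ moves with ∈-toCSet⁻ (_≟ᶜ p) {z} z∈
    ... | refl = ⊥-elim (moves (fixed k))

  Monotone : Fin n → Set
  Monotone k = ∀ {x y} → x ≼[ true ] y → lookup (f x) k ≡ true → lookup (f y) k ≡ true

  monotone-≼ : ∀ {k} → Monotone k → ∀ {x y b} → x ≼[ b ] y → lookup (f x) k ≡ b → lookup (f y) k ≡ b
  monotone-≼ mono {b = true}  x≼y fx = mono x≼y fx
  monotone-≼ mono {b = false} x≼y fx = ¬-not λ fy → not-¬ fx (mono (≼-dual x≼y) fy)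

  no-negative-arc⇒monotone : ∀ {k} → (∀ j → ¬ ArcOf f j k neg) → Monotone k
  no-negative-arc⇒monotone {k} no-arc {x} {y} =
    flip-induction false (λ x → x ≼[ true ] y → lookup (f x) k ≡ true → lookup (f y) k ≡ true) step x
    where
    step : ∀ x → (∀ j → lookup x j ≡ false → flipAt x j ≼[ true ] y →
                   lookup (f (flipAt x j)) k ≡ true → lookup (f y) k ≡ true) →
           x ≼[ true ] y → lookup (f x) k ≡ true → lookup (f y) k ≡ true
    step x ih x≤y fx with any? (λ j → (lookup x j ≟ false) ×-dec (lookup y j ≟ true))
    ... | yes (j , xj , yj) =
      ih j xj (≼-flipAtˡ x≤y yj) (¬-not λ fx′≡false → no-arc j (x , xj , fx , fx′≡false))
    ... | no no-gap = subst (λ z → lookup (f z) k ≡ true) (≼-antisym x≤y y≤x) fx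
      where
      y≤x : y ≼[ true ] x
      y≤x = ≼⁺ λ j yj → ¬-not λ xj → no-gap (j , xj , yj)

  module _ (i : Fin n) where

    Stable : Bool → Config n → Set
    Stable b q = ∀ k → k ≢ i → lookup q k ≡ b → lookup (f q) k ≡ b

    Anchor : Bool → Config n → Set
    Anchor b q = lookup q i ≡ not b × Stable b q

    -- Follow the moves of Γ(f) that turn a coordinate k ≢ i from b into not b, while possible.
    stabilize : ∀ b {T} → TrapSet f T → (Q : Config n → Set) →
                (∀ x k → k ≢ i → lookup x k ≡ b → lookup (f x) k ≢ b → Q x → Q (flipAt x k)) →
                ∀ x → x ∈ T → Q x →
                Σ[ y ∈ Config n ] y ∈ T × lookup y i ≡ lookup x i × Q y × Stable b y
    stabilize b {T} T-trap Q Q-step = flip-induction b Goal step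
      where
      Goal : Config n → Set
      Goal x = x ∈ T → Q x → Σ[ y ∈ Config n ] y ∈ T × lookup y i ≡ lookup x i × Q y × Stable b y
      step : ∀ x → (∀ k → lookup x k ≡ b → Goal (flipAt x k)) → Goal x
      step x ih x∈T qx
        with any? (λ k → ¬? (k ≟ᶠ i) ×-dec (lookup x k ≟ b) ×-dec ¬? (lookup (f x) k ≟ b))
      ... | no settled = x , x∈T , refl , qx , stable
        where
        stable : Stable b x
        stable k k≢i xk = decidable-stable (lookup (f x) k ≟ b) λ fk≢b → settled (k , k≢i , xk , fk≢b)
      ... | yes (k , k≢i , xk , fk≢b)
        with ih k xk (T-trap x k x∈T (fk≢b ∘ λ fk≡xk → trans fk≡xk xk)) (Q-step x k k≢i xk fk≢b qx)
      ...   | y , y∈T , yi , qy , stable =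
              y , y∈T , trans yi (lookup-flipAt′ x (k≢i ∘ sym)) , qy , stable

    stable-both⇒fixed : ∀ {b p} → Stable b p → Stable (not b) p → lookup (f p) i ≡ lookup p i → Fixed p
    stable-both⇒fixed {b} {p} stable stable′ fixed-at-i k with k ≟ᶠ i
    ... | yes refl = fixed-at-i
    ... | no k≢i with lookup p k ≟ b
    ...   | yes pk = trans (stable k k≢i pk) (sym pk)
    ...   | no pk≢b = trans (stable′ k k≢i (¬-not pk≢b)) (sym (¬-not pk≢b))

    module _ (mono : ∀ k → k ≢ i → Monotone k) where

      anchor-upset-trap : ∀ {b q} → Anchor b q → TrapSet f (toCSet (q ≼?[ b ]_))
      anchor-upset-trap {b} {q} (qi , stable) x k x∈ moves =
        ∈-toCSet⁺ (q ≼?[ b ]_) (≼-flipAtʳ q≼x qk≢b)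
        where
        q≼x : q ≼[ b ] x
        q≼x = ∈-toCSet⁻ (q ≼?[ b ]_) x∈
        qk≢b : lookup q k ≢ b
        qk≢b qk = moves (trans (monotone-≼ (mono k k≢i) q≼x (stable k k≢i qk)) (sym (≼-at q≼x k qk)))
          where
          k≢i : k ≢ i
          k≢i refl = not-¬ qk qi

      anchor-below-attractor : ∀ {A b q} → Attractor f A → Anchor b q →
                               ∀ a → a ∈ A → q ≼[ b ] a → ∀ x → x ∈ A → q ≼[ b ] x
      anchor-below-attractor {b = b} {q} att anchor a a∈A q≼a x =
        ∈-toCSet⁻ (q ≼?[ b ]_)
        ∘ attractor-⊆-trapSet att (anchor-upset-trap anchor) a a∈A (∈-toCSet⁺ (q ≼?[ b ]_) q≼a) x

      stable-preserved : ∀ b x k → k ≢ i → lookup x k ≡ not b → lookup (f x) k ≢ not b →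
                         Stable b x → Stable b (flipAt x k)
      stable-preserved b x k k≢i xk fk≢ stable k′ k′≢i x′k′ with k′ ≟ᶠ k
      ... | yes refl = monotone-≼ (mono k k≢i) (≼-flipAt xk) (trans (¬-not fk≢) (not-involutive b))
      ... | no k′≢k = monotone-≼ (mono k′ k′≢i) (≼-flipAt xk)
                                 (stable k′ k′≢i (trans (sym (lookup-flipAt′ x k′≢k)) x′k′))

      anchored-interval-trap : (e : Bool → Config n) → (∀ b → Anchor b (e b)) →
                               (∀ b → e b ≼[ b ] e (not b)) → IsTrapSpace f (interval e)
      anchored-interval-trap e anchors ordered x k x∈ moves =
        span⁺ {x = e true} {e false} {flipAt x k} agree
        where
        settled : ∀ b → lookup (e b) k ≡ b → lookup (f x) k ≡ lookup x k
        settled b ek = trans (monotone-≼ (mono k k≢i) e≼x (proj₂ (anchors b) k k≢i ek))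
                             (sym (≼-at e≼x k ek))
          where
          e≼x : e b ≼[ b ] x
          e≼x = interval⁻ e ordered {x} x∈ b
          k≢i : k ≢ i
          k≢i refl = not-¬ ek (proj₁ (anchors b))
        agree : ∀ j → lookup (e true) j ≡ lookup (e false) j →
                lookup (flipAt x k) j ≡ lookup (e true) j
        agree j et≡ef with j ≟ᶠ k
        ... | no j≢k = trans (lookup-flipAt′ x j≢k) (span⁻ {x = e true} {e false} {x} x∈ j et≡ef)
        ... | yes refl with lookup (e true) j in et
        ...   | true  = ⊥-elim (moves (settled true et))
        ...   | false = ⊥-elim (moves (settled false (sym et≡ef)))

      record Frame (A : CSet n) : Set where
        field
          end           : Bool → Config n
          end∈A         : ∀ b → end b ∈ A
          end-extreme   : ∀ b x → x ∈ A → end b ≼[ b ] x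
          end-stable    : ∀ b → lookup (end b) i ≡ not b → Stable b (end b)
          interval-trap : IsTrapSpace f (interval end)

        ends-ordered : ∀ b → end b ≼[ b ] end (not b)
        ends-ordered b = end-extreme b (end (not b)) (end∈A (not b))

        A⊆interval : ∀ x → x ∈ A → InSub (interval end) x
        A⊆interval x x∈A = interval⁺ end λ b → end-extreme b x x∈A

        interval-least : ∀ {c y} → (∀ x → x ∈ A → InSub c x) → InSub (interval end) y → InSub c y
        interval-least {c} {y} A⊆c =
          span-least {x = end true} {end false} {y} {c} (A⊆c _ (end∈A true)) (A⊆c _ (end∈A false))

        anchor-below : ∀ {y b} → InSub (interval end) y → lookup y i ≡ not b → Anchor b (end b)
        anchor-below {y} {b} y∈ yi = end-i , end-stable b end-i
          where
          end-i : lookup (end b) i ≡ not b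
          end-i = ≼-at (≼-dual (interval⁻ end ends-ordered {y} y∈ b)) i yi

      open Frame

      frame-of-anchors : ∀ {A} → Attractor f A →
                         (∀ b → Σ[ q ∈ Config n ] q ∈ A × Anchor b q) → Frame A
      frame-of-anchors {A} att anchors = record
        { end           = q
        ; end∈A         = q∈A
        ; end-extreme   = extreme
        ; end-stable    = λ b _ → proj₂ (anchor b)
        ; interval-trap = anchored-interval-trap q anchor λ b → extreme b _ (q∈A (not b))
        }
        where
        q : Bool → Config n
        q = proj₁ ∘ anchors
        q∈A : ∀ b → q b ∈ A
        q∈A = proj₁ ∘ proj₂ ∘ anchors
        anchor : ∀ b → Anchor b (q b)
        anchor = proj₂ ∘ proj₂ ∘ anchors
        extreme : ∀ b x → x ∈ A → q b ≼[ b ] x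
        extreme b = anchor-below-attractor att (anchor b) _ (q∈A b) ≼-refl

      frame-of-fixed : ∀ {A p} → Attractor f A → p ∈ A → Fixed p → Frame A
      frame-of-fixed {p = p} att p∈A fixed = record
        { end           = λ _ → p
        ; end∈A         = λ _ → p∈A
        ; end-extreme   = λ b x x∈A →
                            subst (p ≼[ b ]_) (sym (fixed-attractor-singleton att p∈A fixed x x∈A)) ≼-refl
        ; end-stable    = λ _ _ k _ pk → trans (fixed k) pk
        ; interval-trap = singleton-trap
        }
        where
        singleton-trap : IsTrapSpace f (span p p)
        singleton-trap x k x∈ moves
          with lookup-ext {x = x} {p} (λ j → span⁻ {x = p} {p} {x} x∈ j refl)
        ... | refl = ⊥-elim (moves (fixed k))

      -- From a ∈ A reach a b-stable y with y i = not b, then a point p that is stable for both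
      -- signs; either p is a fixed point, or flipping i and stabilizing gives a (not b)-anchor.
      attractor-frame : ∀ {A} → Attractor f A → Frame A
      attractor-frame {A} att@((a , a∈A) , A-trap , _) =
        frame-from (not (lookup a i)) (sym (not-involutive _))
        where
        frame-from : ∀ b → lookup a i ≡ not b → Frame A
        frame-from b ai
          with stabilize b A-trap (λ _ → ⊤) _ a a∈A tt
        ... | y , y∈A , yi , _ , y-stable
          with stabilize (not b) A-trap (Stable b) (stable-preserved b) y y∈A y-stable
        ... | p , p∈A , pi , p-stable , p-stable′
          with lookup (f p) i ≟ lookup p i
        ... | yes fixed-at-i = frame-of-fixed att p∈A (stable-both⇒fixed p-stable p-stable′ fixed-at-i)
        ... | no moves-at-i
          with stabilize (not b) A-trap (λ _ → ⊤) _ (flipAt p i) (A-trap p i p∈A moves-at-i) tt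
        ...   | q , q∈A , qi , _ , q-stable =
                frame-of-anchors att (both-signs b (p , p∈A , pi′ , p-stable) (q , q∈A , qi′ , q-stable))
          where
          pi′ : lookup p i ≡ not b
          pi′ = trans pi (trans yi ai)
          qi′ : lookup q i ≡ not (not b)
          qi′ = trans qi (trans (lookup-flipAt p i) (cong not pi′))

      hulls-agree : ∀ {A} → Attractor f A → ∀ y → InSubHull A y ⇔ InTrapHull f A y
      hulls-agree {A} att y = mk⇔ (subHull⇒trapHull {A} {y}) λ y∈⟨A⟩ c A⊆c →
        interval-least F {c} {y} A⊆c (y∈⟨A⟩ (interval (end F)) (interval-trap F) (A⊆interval F))
        where
        F : Frame A
        F = attractor-frame att

      frame-ends-below : ∀ {A B y b} → Attractor f A → (FA : Frame A) (FB : Frame B) →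
                         InSub (interval (end FA)) y → InSub (interval (end FB)) y → lookup y i ≡ not b →
                         end FB b ≼[ b ] end FA b
      frame-ends-below {y = y} {b} att FA FB y∈A y∈B yi =
        anchor-below-attractor att (anchor-below FB {y} y∈B yi) _ (end∈A FA (not b))
          (≼-trans (interval⁻ (end FB) (ends-ordered FB) {y} y∈B b)
                   (≼-dual⁻ (interval⁻ (end FA) (ends-ordered FA) {y} y∈A (not b))))
          _ (end∈A FA b)

      hulls-meet⇒attractors-meet : ∀ {A B y} → Attractor f A → Attractor f B →
                                   InSubHull A y → InSubHull B y → ∃[ x ] x ∈ A × x ∈ B
      hulls-meet⇒attractors-meet {A} {B} {y} A-att B-att y∈[A] y∈[B] =
        end FA b , end∈A FA b , subst (_∈ B) (≼-antisym B≼A A≼B) (end∈A FB b)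
        where
        FA : Frame A
        FA = attractor-frame A-att
        FB : Frame B
        FB = attractor-frame B-att
        b : Bool
        b = not (lookup y i)
        yi : lookup y i ≡ not b
        yi = sym (not-involutive _)
        y∈A : InSub (interval (end FA)) y
        y∈A = y∈[A] (interval (end FA)) (A⊆interval FA)
        y∈B : InSub (interval (end FB)) y
        y∈B = y∈[B] (interval (end FB)) (A⊆interval FB)
        B≼A : end FB b ≼[ b ] end FA b
        B≼A = frame-ends-below {y = y} A-att FA FB y∈A y∈B yi
        A≼B : end FA b ≼[ b ] end FB b
        A≼B = frame-ends-below {y = y} B-att FB FA y∈B y∈A yi

      trapping : TrappingΓ f
      trapping = distinct-disjoint , λ A att → hulls-agree {A} att
        where
        distinct-disjoint : ∀ A B → Attractor f A → Attractor f B → ¬ (∀ x → A x ≡ B x) →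
                            ¬ (∃ λ y → InSubHull A y × InSubHull B y)
        distinct-disjoint A B A-att B-att A≢B (y , y∈[A] , y∈[B]) =
          let x , x∈A , x∈B = hulls-meet⇒attractors-meet {A} {B} {y} A-att B-att y∈[A] y∈[B]
          in A≢B (attractors-meet⇒≡ A-att B-att x x∈A x∈B)

trapping-on-no-vertices : (f : BN 0) → TrappingΓ f
trapping-on-no-vertices f = distinct-disjoint , λ A _ y → mk⇔ (subHull⇒trapHull f {A} {y}) λ _ _ _ ()
  where
  distinct-disjoint : ∀ A B → Attractor f A → Attractor f B → ¬ (∀ x → A x ≡ B x) →
                      ¬ (∃ λ y → InSubHull A y × InSubHull B y)
  distinct-disjoint A B (([] , []∈A) , _) (([] , []∈B) , _) A≢B _ = A≢B λ { [] → trans []∈A (sym []∈B) }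

common-negative-target : (G : SignedDigraph n) {f : BN n} → InF G f → NegArcsSameTarget G →
                         Fin n → Σ[ i ∈ Fin n ] (∀ j k → ArcOf f j k neg → k ≡ i)
common-negative-target G f∈F same-target i₀
  with any? (λ j → any? (λ k → G j k neg ≟ true))
... | yes (j₀ , k₀ , arc₀) =
  k₀ , λ j k arc → same-target j k j₀ k₀ (Equivalence.to (f∈F j k neg) arc) arc₀
... | no no-arc = i₀ , λ j k arc → ⊥-elim (no-arc (j , k , Equivalence.to (f∈F j k neg) arc))

lemma37 : (n : ℕ) (G : SignedDigraph n) → NegArcsSameTarget G → TrappingG G
lemma37 zero    G same-target f f∈F = trapping-on-no-vertices f
lemma37 (suc n) G same-target f f∈F with common-negative-target G f∈F same-target fzero
... | i , into-i = trapping f i λ k k≢i → no-negative-arc⇒monotone f λ j arc → k≢i (into-i j k arc)
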